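{- Let $G$ be a formula, $N=|G|$ (number of symbols), $\mathcal D$ an $\mathbf{FRJ}(G)$-derivation and $\mathcal B=\sigma_1,\dots,\sigma_m$ a branch of $\mathcal D$, i.e. a sequence of sequents of $\mathcal D$ with $\sigma_1\mapsto_0\sigma_2\mapsto_0\cdots\mapsto_0\sigma_m$. Then (i) the length $m$ of $\mathcal B$ is $O(N^2)$; (ii) $\mathcal B$ contains at most $N$ p-sequents.
   Context: Formulas are built from a countably infinite set $\mathcal{V}$ of propositional variables and $\bot$ using $\land,\lor,\supset$. Let $\mathcal{V}_\bot=\mathcal{V}\cup\{\bot\}$, $\mathcal{L}^{\supset}$ the set of formulas with main connective $\supset$. For a formula $G$, $\mathrm{Sl}(G)$ and $\mathrm{Sr}(G)$ are the smallest subsets of the subformulas of $G$ with: $G\in\mathrm{Sr}(G)$; $A\land B$ or $A\lor B$ in $\mathrm{Sl}(G)$ (resp. $\mathrm{Sr}(G)$) implies $A,B$ in $\mathrm{Sl}(G)$ (resp. $\mathrm{Sr}(G)$); $A\supset B\in\mathrm{Sl}(G)$ implies $B\in\mathrm{Sl}(G)$, $A\in\mathrm{Sr}(G)$; $A\supset B\in\mathrm{Sr}(G)$ implies $B\in\mathrm{Sr}(G)$, $A\in\mathrm{Sl}(G)$. $\mathrm{Cl}(\Gamma)$ is the smallest set containing $\Gamma$ such that if $X,Y\in\mathrm{Cl}(\Gamma)$ and $A$ is any formula then $X\land Y,A\lor X,X\lor A,A\supset X\in\mathrm{Cl}(\Gamma)$. $\mathbf{FRJ}(G)$: let $\bar\Gamma^{At}=\mathrm{Sl}(G)\cap\mathcal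 V$, $\bar\Gamma^{\supset}=\mathrm{Sl}(G)\cap\mathcal L^{\supset}$, $\bar\Gamma=\bar\Gamma^{At}\cup\bar\Gamma^{\supset}$. Sequents: regular $\Gamma\Rightarrow C$ ($\Gamma\subseteq\bar\Gamma$, $C\in\mathrm{Sr}(G)$), irregular $\Sigma;\Theta\rightarrow C$ ($\Sigma\cup\Theta\subseteq\bar\Gamma$, $C\in\mathrm{Sr}(G)$); conclusions always have right formula in $\mathrm{Sr}(G)$. Rules ($F\in\mathcal V_\bot$, $k\in\{1,2\}$): axioms $\bar\Gamma^{At}\setminus\{F\}\Rightarrow F$ and $\emptyset;(\bar\Gamma^{At}\setminus\{F\})\cup\bar\Gamma^{\supset}\rightarrow F$; ($\land$) $\Gamma\Rightarrow A_k/\Gamma\Rightarrow A_1\land A_2$ and $\Sigma;\Theta\rightarrow A_k/\Sigma;\Theta\rightarrow A_1\land A_2$; ($\lor$) $\Sigma_1;\Theta_1\rightarrow C_1$, $\Sigma_2;\Theta_2\rightarrow C_2 / \Sigma_1\cup\Sigma_2;\Theta_1\cap\Theta_2\rightarrow C_1\lor C_2$ if $\Sigma_1\subseteq\Sigma_2\cup\Theta_2$, $\Sigma_2\subseteq\Sigma_1\cup\Theta_1$; ($\supset_\in$) $\Gamma\Rightarrow B/\Gamma\Rightarrow A\supset B$ if $A\in\mathrm{Cl}(\Gamma)$, and $\Sigma;\Theta\cup\Lambda\rightarrow B/\Sigma\cup\Lambda;\Theta\rightarrow A\supset B$ if $\Theta\cap\Lambda=\emptyset$, $A\in\mathrm{Cl}(\Sigma\cup\Lambda)$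 and no $\Lambda'\subsetneq\Lambda$ has $A\in\mathrm{Cl}(\Sigma\cup\Lambda')$; ($\supset_{\notin}$) $\Gamma\Rightarrow B/\emptyset;\Theta\rightarrow A\supset B$ if $\Theta\subseteq\mathrm{Cl}(\Gamma)\cap\bar\Gamma$, $A\in\mathrm{Cl}(\Gamma)\setminus\mathrm{Cl}(\Theta)$ and every $\Theta'$ with $\Theta\subsetneq\Theta'\subseteq\mathrm{Cl}(\Gamma)\cap\bar\Gamma$ has $A\in\mathrm{Cl}(\Theta')$; join rules with premises $\Sigma_j;\Theta_j\rightarrow A_j$ ($1\le j\le n$, $n\ge1$): let $\Upsilon=\{A_1,\dots,A_n\}$, $\Sigma^{At}=\bigcup_j(\Sigma_j\cap\mathcal V)$, $\Sigma^{\supset}=\bigcup_j(\Sigma_j\cap\mathcal L^{\supset})$, $\Theta^{At}=\bigcap_j(\Theta_j\cap\mathcal V)$, $\Theta^{\supset}=\{Y\supset Z\in\bigcap_j(\Theta_j\cap\mathcal L^{\supset}):Y\in\Upsilon\}$, requiring $\Sigma_i\subseteq\Sigma_j\cup\Theta_j$ ($i\ne j$) and ($Y\supset Z\in\Sigma^{\supset}\Rightarrow Y\in\Upsilon$); ($\bowtie^{At}$) conclusion $\Sigma^{At}\cup(\Theta^{At}\setminus\{F\})\cup\Sigma^{\supset}\cup\Theta^{\supset}\Rightarrow F$, $F\in\mathcal V_\bot\setminus\Sigma^{At}$, where each $Y\in\Upsilon$ has some $Y\supset Z\in\mathrm{Sl}(G)$; ($\bowtie^{\lor}$) conclusion $\Sigma^{At}\cup\Theta^{At}\cup\Sigma^{\supset}\cup\Theta^{\supset}\Rightarrow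 C_1\lor C_2$, $\{C_1,C_2\}\subseteq\Upsilon$, where each $Y\in\Upsilon$ has some $Y\supset Z\in\mathrm{Sl}(G)$ or $Y\lor Z\in\mathrm{Sr}(G)$ or $Z\lor Y\in\mathrm{Sr}(G)$. A derivation is a finite tree of sequents built with these rules, axioms at the leaves. Write $\sigma_1\mapsto_0\sigma_2$ if some rule instance has conclusion $\sigma_2$ and $\sigma_1$ among its premises. A p-sequent of $\mathcal D$ is a regular sequent occurring in $\mathcal D$ that is an axiom or the conclusion of a join rule. -}

module Defs where

open import Data.Nat using (ℕ; suc; _+_)
open import Data.Empty using (⊥)
open import Data.Unit using (⊤)
open import Data.Product using (Σ; proj₁; Σ-syntax; ∃; ∃-syntax; _×_; _,_)
open import Data.Sum using (_⊎_)
open import Data.List using (List; []; _∷_; _++_; map)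
open import Data.List.Membership.Propositional using (_∈_; _∉_)
open import Data.List.Relation.Unary.All using (All)
open import Data.List.Relation.Unary.Any using (Any)
open import Data.List.Relation.Unary.Linked using (Linked)
open import Relation.Nullary using (¬_)
open import Relation.Binary.PropositionalEquality using (_≡_; _≢_)
open import Function.Bundles using (_⇔_)

infixr 6 _∧'_
infixr 5 _∨'_
infixr 4 _⊃_

data Formula : Set where
  atom : ℕ → Formula
  ⊥'   : Formula
  _∧'_ : Formula → Formula → Formula
  _∨'_ : Formula → Formula → Formula
  _⊃_  : Formula → Formula → Formula

size : Formula → ℕ
size (atom _) = 1
size ⊥'       = 1
size (A ∧' B) = suc (size A + size B)
size (A ∨' B) = suc (size A + size B)
size (A ⊃ B)  = suc (size A + size B)

IsVar : Formula → Set
IsVar X = ∃[ n ] X ≡ atom n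

IsVar⊥ : Formula → Set
IsVar⊥ X = IsVar X ⊎ X ≡ ⊥'

IsImp : Formula → Set
IsImp X = ∃[ A ] ∃[ B ] X ≡ (A ⊃ B)

mutual
  data Sl (G : Formula) : Formula → Set where
    sl-∧₁ : ∀ {A B} → Sl G (A ∧' B) → Sl G A
    sl-∧₂ : ∀ {A B} → Sl G (A ∧' B) → Sl G B
    sl-∨₁ : ∀ {A B} → Sl G (A ∨' B) → Sl G A
    sl-∨₂ : ∀ {A B} → Sl G (A ∨' B) → Sl G B
    sl-⊃  : ∀ {A B} → Sl G (A ⊃ B) → Sl G B
    sr-⊃l : ∀ {A B} → Sr G (A ⊃ B) → Sl G A

  data Sr (G : Formula) : Formula → Set where
    sr-root : Sr G G
    sr-∧₁ : ∀ {A B} → Sr G (A ∧' B) → Sr G A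
    sr-∧₂ : ∀ {A B} → Sr G (A ∧' B) → Sr G B
    sr-∨₁ : ∀ {A B} → Sr G (A ∨' B) → Sr G A
    sr-∨₂ : ∀ {A B} → Sr G (A ∨' B) → Sr G B
    sr-⊃  : ∀ {A B} → Sr G (A ⊃ B) → Sr G B
    sl-⊃l : ∀ {A B} → Sl G (A ⊃ B) → Sr G A

ΓAt : Formula → Formula → Set
ΓAt G X = Sl G X × IsVar X

Γ⊃ : Formula → Formula → Set
Γ⊃ G X = Sl G X × IsImp X

Γbar : Formula → Formula → Set
Γbar G X = ΓAt G X ⊎ Γ⊃ G X

-- Finite sets of formulas are represented by lists (up to set equality).

_⊆_ : List Formula → List Formula → Set
Γ ⊆ Δ = ∀ {X} → X ∈ Γ → X ∈ Δ

_≋_ : List Formula → List Formula → Set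
Γ ≋ Δ = Γ ⊆ Δ × Δ ⊆ Γ

_⊊_ : List Formula → List Formula → Set
Γ ⊊ Δ = Γ ⊆ Δ × ¬ (Δ ⊆ Γ)

_⊆ₚ_ : List Formula → (Formula → Set) → Set
Γ ⊆ₚ P = ∀ {X} → X ∈ Γ → P X

_≐_ : List Formula → (Formula → Set) → Set
Γ ≐ P = ∀ X → (X ∈ Γ) ⇔ P X

data Cl (Γ : List Formula) : Formula → Set where
  cl-base : ∀ {X} → X ∈ Γ → Cl Γ X
  cl-∧    : ∀ {X Y} → Cl Γ X → Cl Γ Y → Cl Γ (X ∧' Y)
  cl-∨l   : ∀ {X} A → Cl Γ X → Cl Γ (A ∨' X)
  cl-∨r   : ∀ {X} A → Cl Γ X → Cl Γ (X ∨' A)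
  cl-⊃    : ∀ {X} A → Cl Γ X → Cl Γ (A ⊃ X)

data Seq : Set where
  reg : List Formula → Formula → Seq                 -- Γ ⇒ C
  irr : List Formula → List Formula → Formula → Seq  -- Σ ; Θ → C

_≈_ : Seq → Seq → Set
reg Γ C ≈ reg Γ' C' = Γ ≋ Γ' × C ≡ C'
reg _ _ ≈ irr _ _ _ = ⊥
irr _ _ _ ≈ reg _ _ = ⊥
irr Σ Θ C ≈ irr Σ' Θ' C' = Σ ≋ Σ' × Θ ≋ Θ' × C ≡ C'

WF : Formula → Seq → Set
WF G (reg Γ C)   = Γ ⊆ₚ Γbar G × Sr G C
WF G (irr Σ Θ C) = Σ ⊆ₚ Γbar G × Θ ⊆ₚ Γbar G × Sr G C

-- Join rules: premises Σ_j ; Θ_j → A_j, given as a nonempty list of triples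

JPrem : Set
JPrem = List Formula × List Formula × Formula

toIrr : JPrem → Seq
toIrr (Σ , Θ , A) = irr Σ Θ A

module Join (qs : List JPrem) where
  Υ : Formula → Set
  Υ X = ∃[ Σ ] ∃[ Θ ] (Σ , Θ , X) ∈ qs

  ΣAt : Formula → Set
  ΣAt X = IsVar X × ∃[ Σ ] ∃[ Θ ] ∃[ A ] ((Σ , Θ , A) ∈ qs × X ∈ Σ)

  Σ⊃ : Formula → Set
  Σ⊃ X = IsImp X × ∃[ Σ ] ∃[ Θ ] ∃[ A ] ((Σ , Θ , A) ∈ qs × X ∈ Σ)

  ΘAt : Formula → Set
  ΘAt X = IsVar X × (∀ {Σ Θ A} → (Σ , Θ , A) ∈ qs → X ∈ Θ)

  Θ⊃ : Formula → Set
  Θ⊃ X = ∃[ Y ] ∃[ Z ] (X ≡ (Y ⊃ Z) × (∀ {Σ Θ A} → (Σ , Θ , A) ∈ qs → X ∈ Θ) × Υ Y)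

  JoinCond : Set
  JoinCond =
    (∀ {Σ Θ A Σ' Θ' A'} → (Σ , Θ , A) ∈ qs → (Σ' , Θ' , A') ∈ qs →
        ∀ {X} → X ∈ Σ → X ∈ Σ' ⊎ X ∈ Θ')
    × (∀ {Y Z} → Σ⊃ (Y ⊃ Z) → Υ Y)

-- Rule instances of FRJ(G): Rule G ps σ  (premises ps, conclusion σ)

data Rule (G : Formula) : List Seq → Seq → Set where
  ax-reg : ∀ {Γ F} → IsVar⊥ F →
           Γ ≐ (λ X → ΓAt G X × X ≢ F) →
           Rule G [] (reg Γ F)
  ax-irr : ∀ {Σ Θ F} → IsVar⊥ F →
           Σ ≐ (λ _ → ⊥) →
           Θ ≐ (λ X → (ΓAt G X × X ≢ F) ⊎ Γ⊃ G X) →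
           Rule G [] (irr Σ Θ F)
  ∧-reg  : ∀ {Γ Γ' A A₁ A₂} → (A ≡ A₁ ⊎ A ≡ A₂) → Γ' ≋ Γ →
           Rule G (reg Γ A ∷ []) (reg Γ' (A₁ ∧' A₂))
  ∧-irr  : ∀ {Σ Θ Σ' Θ' A A₁ A₂} → (A ≡ A₁ ⊎ A ≡ A₂) → Σ' ≋ Σ → Θ' ≋ Θ →
           Rule G (irr Σ Θ A ∷ []) (irr Σ' Θ' (A₁ ∧' A₂))
  ∨-irr  : ∀ {Σ₁ Θ₁ C₁ Σ₂ Θ₂ C₂ Σ Θ} →
           (∀ {X} → X ∈ Σ₁ → X ∈ Σ₂ ⊎ X ∈ Θ₂) →
           (∀ {X} → X ∈ Σ₂ → X ∈ Σ₁ ⊎ X ∈ Θ₁) →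
           Σ ≐ (λ X → X ∈ Σ₁ ⊎ X ∈ Σ₂) →
           Θ ≐ (λ X → X ∈ Θ₁ × X ∈ Θ₂) →
           Rule G (irr Σ₁ Θ₁ C₁ ∷ irr Σ₂ Θ₂ C₂ ∷ []) (irr Σ Θ (C₁ ∨' C₂))
  ⊃∈-reg : ∀ {Γ Γ' A B} → Γ' ≋ Γ → Cl Γ A →
           Rule G (reg Γ B ∷ []) (reg Γ' (A ⊃ B))
  -- premise Σ ; Θ ∪ Λ → B  (list Θ₀ representing Θ ∪ Λ),
  -- conclusion Σ ∪ Λ ; Θ → A ⊃ B  (list Σ' representing Σ ∪ Λ)
  ⊃∈-irr : ∀ {Σ Θ₀ Σ' Θ' A B} (Θ Λ : List Formula) →
           Θ₀ ≐ (λ X → X ∈ Θ ⊎ X ∈ Λ) →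
           Σ' ≐ (λ X → X ∈ Σ ⊎ X ∈ Λ) →
           Θ' ≋ Θ →
           (∀ {X} → X ∈ Θ → X ∉ Λ) →
           Cl (Σ ++ Λ) A →
           (∀ Λ' → Λ' ⊊ Λ → ¬ Cl (Σ ++ Λ') A) →
           Rule G (irr Σ Θ₀ B ∷ []) (irr Σ' Θ' (A ⊃ B))
  ⊃∉     : ∀ {Γ Σ Θ A B} →
           Σ ≐ (λ _ → ⊥) →
           Θ ⊆ₚ (λ X → Cl Γ X × Γbar G X) →
           Cl Γ A → ¬ Cl Θ A →
           (∀ Θ'' → Θ ⊊ Θ'' → Θ'' ⊆ₚ (λ X → Cl Γ X × Γbar G X) → Cl Θ'' A) →
           Rule G (reg Γ B ∷ []) (irr Σ Θ (A ⊃ B))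
  ⋈At    : ∀ {Γ F} (qs : List JPrem) → qs ≢ [] →
           Join.JoinCond qs →
           IsVar⊥ F → ¬ Join.ΣAt qs F →
           (∀ {Y} → Join.Υ qs Y → ∃[ Z ] Sl G (Y ⊃ Z)) →
           Γ ≐ (λ X → Join.ΣAt qs X ⊎ (Join.ΘAt qs X × X ≢ F)
                       ⊎ Join.Σ⊃ qs X ⊎ Join.Θ⊃ qs X) →
           Rule G (map toIrr qs) (reg Γ F)
  ⋈∨     : ∀ {Γ C₁ C₂} (qs : List JPrem) → qs ≢ [] →
           Join.JoinCond qs →
           Join.Υ qs C₁ → Join.Υ qs C₂ →
           (∀ {Y} → Join.Υ qs Y →
              ∃[ Z ] (Sl G (Y ⊃ Z) ⊎ Sr G (Y ∨' Z) ⊎ Sr G (Z ∨' Y))) →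
           Γ ≐ (λ X → Join.ΣAt qs X ⊎ Join.ΘAt qs X
                       ⊎ Join.Σ⊃ qs X ⊎ Join.Θ⊃ qs X) →
           Rule G (map toIrr qs) (reg Γ (C₁ ∨' C₂))

Inst : Formula → List Seq → Seq → Set
Inst G ps σ = Rule G ps σ × All (WF G) ps × WF G σ

-- rules whose regular conclusions are p-sequents: regular axioms and joins
IsPRule : ∀ {G ps σ} → Rule G ps σ → Set
IsPRule (ax-reg _ _) = ⊤
IsPRule (⋈At _ _ _ _ _ _ _) = ⊤
IsPRule (⋈∨ _ _ _ _ _ _ _) = ⊤
IsPRule _ = ⊥

data Deriv (G : Formula) : Seq → Set where
  by : ∀ {ps σ} → Inst G ps σ → (∀ {τ} → τ ∈ ps → Deriv G τ) → Deriv G σ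

-- nodes of a derivation: Node D ρ  says that the rule instance ρ is applied
-- at some node of D
data Node {G : Formula} : ∀ {σ} → Deriv G σ → ∀ {ps τ} → Inst G ps τ → Set where
  here  : ∀ {ps σ} {ι : Inst G ps σ} {ds : ∀ {τ} → τ ∈ ps → Deriv G τ} →
          Node (by ι ds) ι
  there : ∀ {ps σ} {ι : Inst G ps σ} {ds : ∀ {τ} → τ ∈ ps → Deriv G τ}
            {τ} (m : τ ∈ ps) {qs ρ} {κ : Inst G qs ρ} →
          Node (ds m) κ → Node (by ι ds) κ

Occurs : ∀ {G σ} → Deriv G σ → Seq → Set
Occurs {G} D σ = ∃[ ps ] ∃[ τ ] Σ[ ι ∈ Inst G ps τ ] (Node D ι × τ ≈ σ)

-- σ is a p-sequent of D: a regular sequent occurring in D that is an axiom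
-- or the conclusion of a join rule (at its occurrence in D)
PSeq : ∀ {G σ} → Deriv G σ → Seq → Set
PSeq {G} D σ = ∃[ ps ] ∃[ τ ] Σ[ ι ∈ Inst G ps τ ]
                 (Node D ι × τ ≈ σ × IsPRule (proj₁ ι))

_↦₀_ : ∀ {G : Formula} → Seq → Seq → Set
_↦₀_ {G} σ₁ σ₂ = ∃[ ps ] (Inst G ps σ₂ × Any (σ₁ ≈_) ps)

Branch : ∀ {G σ} → Deriv G σ → List Seq → Set
Branch {G} D B = All (Occurs D) B × Linked (_↦₀_ {G}) B

-- Measure a sequent by the number of proper subformulas of G that lie in the closure Cl of
-- its left-hand side, doubled, plus one if the sequent is irregular.  Going from a premise to
-- the conclusion of a rule never increases this level: ⊃∉ and the join rules lower it, and
-- every other rule keeps the left-hand side up to inclusion while the right formula grows to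
-- a larger subformula of G.  So along a branch the pair (level, size of the right formula)
-- decreases lexicographically within a range of size O(N) × O(N), which bounds the length
-- by O(N²).  The right formula of a p-sequent is in 𝒱⊥ or a disjunction, which no rule but an
-- axiom or a join produces, so between two p-sequents of a branch the level drops strictly.
-- Both are regular, hence the count itself drops, and it is smaller than N.
module Submission where

open import Defs
open import Data.Nat using (ℕ; _≤_; _*_)
open import Data.Product using (Σ; _×_)
open import Data.List using (List; length)
open import Data.List.Relation.Unary.All using (All)
open import Data.List.Relation.Binary.Sublist.Propositional using () renaming (_⊆_ to _⊑_)

open import Data.Nat using (zero; suc; _+_; _∸_; _<_; z≤n; s≤s)
import Data.Nat as ℕ
open import Data.Nat.Properties
  using ( ≤-trans; <-≤-trans; <⇒≤; ≤∧≢⇒<; n≤1+n; m≤m+n; m≤n+m; m∸n≤m; +-comm; +-identityʳ; *-suc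
        ; +-monoʳ-<; +-mono-≤-<; *-monoʳ-≤; ∸-monoʳ-<; *-cancelˡ-<; module ≤-Reasoning)
open import Data.Nat.Tactic.RingSolver using (solve-∀)
open import Data.Product using (_,_; proj₁; proj₂; ∃-syntax; uncurry)
open import Data.Sum using (_⊎_; inj₁; inj₂; [_,_]′)
import Data.Sum as Sum
open import Data.Empty using (⊥; ⊥-elim)
open import Data.Unit using (⊤; tt)
open import Data.List using ([]; _∷_; _++_; filter)
open import Data.List.Properties using (length-++; length-filter)
open import Data.List.Membership.Propositional using (_∈_; find)
open import Data.List.Membership.Propositional.Properties
  using (∈-++⁻; ∈-++⁺ʳ; ∈-map⁻; ++-∈⇔; ∈-filter⁺; ∈-filter⁻)
open import Data.List.Relation.Unary.All using ([]; _∷_; all?)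
import Data.List.Relation.Unary.All as All
open import Data.List.Relation.Unary.All.Properties using (¬All⇒Any¬)
open import Data.List.Relation.Unary.Any using (here; there)
open import Data.List.Relation.Unary.Linked using (Linked; []; [-]; _∷_)
import Data.List.Relation.Unary.Linked as Linked
open import Data.List.Relation.Unary.Linked.Properties using (Linked⇒AllPairs)
open import Data.List.Relation.Unary.AllPairs using (AllPairs; []; _∷_)
open import Data.List.Relation.Binary.Equality.Propositional using (≋⇒≡)
open import Data.List.Relation.Binary.Sublist.Propositional using ([]; _∷_; _∷ʳ_; ⊆-refl; lookup)
import Data.List.Relation.Binary.Sublist.Propositional.Properties as Sublist
import Data.List.Relation.Binary.Subset.Propositional.Properties as Subset
open import Relation.Nullary using (¬_; yes; no)
open import Relation.Nullary.Decidable using (map′; _×-dec_; _⊎-dec_)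
open import Relation.Unary using (Pred; Decidable)
open import Relation.Binary.Definitions using (DecidableEquality; Transitive)
open import Relation.Binary.PropositionalEquality
  using (_≡_; refl; sym; trans; cong; cong₂; subst; subst₂)
open import Function using (_∘_; id)
open import Function.Bundles using (Equivalence)
open Equivalence using (to; from)

infix 4 _≟_
_≟_ : DecidableEquality Formula
atom m ≟ atom n = map′ (cong atom) (λ { refl → refl }) (m ℕ.≟ n)
⊥' ≟ ⊥' = yes refl
(A ∧' B) ≟ (C ∧' D) = map′ (uncurry (cong₂ _∧'_)) (λ { refl → refl , refl }) (A ≟ C ×-dec B ≟ D)
(A ∨' B) ≟ (C ∨' D) = map′ (uncurry (cong₂ _∨'_)) (λ { refl → refl , refl }) (A ≟ C ×-dec B ≟ D)
(A ⊃ B) ≟ (C ⊃ D) = map′ (uncurry (cong₂ _⊃_)) (λ { refl → refl , refl }) (A ≟ C ×-dec B ≟ D)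
atom _ ≟ ⊥' = no λ ()
atom _ ≟ (_ ∧' _) = no λ ()
atom _ ≟ (_ ∨' _) = no λ ()
atom _ ≟ (_ ⊃ _) = no λ ()
⊥' ≟ atom _ = no λ ()
⊥' ≟ (_ ∧' _) = no λ ()
⊥' ≟ (_ ∨' _) = no λ ()
⊥' ≟ (_ ⊃ _) = no λ ()
(_ ∧' _) ≟ atom _ = no λ ()
(_ ∧' _) ≟ ⊥' = no λ ()
(_ ∧' _) ≟ (_ ∨' _) = no λ ()
(_ ∧' _) ≟ (_ ⊃ _) = no λ ()
(_ ∨' _) ≟ atom _ = no λ ()
(_ ∨' _) ≟ ⊥' = no λ ()
(_ ∨' _) ≟ (_ ∧' _) = no λ ()
(_ ∨' _) ≟ (_ ⊃ _) = no λ ()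
(_ ⊃ _) ≟ atom _ = no λ ()
(_ ⊃ _) ≟ ⊥' = no λ ()
(_ ⊃ _) ≟ (_ ∧' _) = no λ ()
(_ ⊃ _) ≟ (_ ∨' _) = no λ ()

open import Data.List.Membership.DecPropositional _≟_ using (_∈?_)

Cl? : ∀ Γ → Decidable (Cl Γ)
Cl? Γ (atom n) = map′ cl-base (λ { (cl-base x) → x }) (atom n ∈? Γ)
Cl? Γ ⊥' = map′ cl-base (λ { (cl-base x) → x }) (⊥' ∈? Γ)
Cl? Γ (A ∧' B) =
  map′ [ cl-base , uncurry cl-∧ ]′ (λ { (cl-base x) → inj₁ x ; (cl-∧ a b) → inj₂ (a , b) })
       ((A ∧' B) ∈? Γ ⊎-dec (Cl? Γ A ×-dec Cl? Γ B))
Cl? Γ (A ∨' B) =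
  map′ [ cl-base , [ cl-∨l A , cl-∨r B ]′ ]′
       (λ { (cl-base x) → inj₁ x ; (cl-∨l _ b) → inj₂ (inj₁ b) ; (cl-∨r _ a) → inj₂ (inj₂ a) })
       ((A ∨' B) ∈? Γ ⊎-dec (Cl? Γ B ⊎-dec Cl? Γ A))
Cl? Γ (A ⊃ B) =
  map′ [ cl-base , cl-⊃ A ]′ (λ { (cl-base x) → inj₁ x ; (cl-⊃ _ b) → inj₂ b })
       ((A ⊃ B) ∈? Γ ⊎-dec Cl? Γ B)

Cl-bind : ∀ {Γ Δ} → (∀ {X} → X ∈ Γ → Cl Δ X) → ∀ {A} → Cl Γ A → Cl Δ A
Cl-bind f (cl-base x) = f x
Cl-bind f (cl-∧ a b) = cl-∧ (Cl-bind f a) (Cl-bind f b)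
Cl-bind f (cl-∨l A x) = cl-∨l A (Cl-bind f x)
Cl-bind f (cl-∨r A x) = cl-∨r A (Cl-bind f x)
Cl-bind f (cl-⊃ A x) = cl-⊃ A (Cl-bind f x)

Cl-mono : ∀ {Γ Δ} → Γ ⊆ Δ → ∀ {A} → Cl Γ A → Cl Δ A
Cl-mono Γ⊆Δ = Cl-bind (cl-base ∘ Γ⊆Δ)

Cl-generator-∉ : ∀ {Γ Δ A} → Cl Γ A → ¬ Cl Δ A → ∃[ X ] (X ∈ Γ × ¬ Cl Δ X)
Cl-generator-∉ {Γ} {Δ} A ¬A with all? (Cl? Δ) Γ
... | yes Γ⊆ = ⊥-elim (¬A (Cl-bind (All.lookup Γ⊆) A))
... | no ¬Γ⊆ = find (¬All⇒Any¬ (Cl? Δ) Γ ¬Γ⊆)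

mutual
  subformulas : Formula → List Formula
  subformulas X = X ∷ properSubformulas X

  properSubformulas : Formula → List Formula
  properSubformulas (atom _) = []
  properSubformulas ⊥' = []
  properSubformulas (A ∧' B) = subformulas A ++ subformulas B
  properSubformulas (A ∨' B) = subformulas A ++ subformulas B
  properSubformulas (A ⊃ B) = subformulas A ++ subformulas B

mutual
  length-subformulas : ∀ X → length (subformulas X) ≡ size X
  length-subformulas (atom _) = refl
  length-subformulas ⊥' = refl
  length-subformulas (A ∧' B) = cong suc (length-subformulas-++ A B)
  length-subformulas (A ∨' B) = cong suc (length-subformulas-++ A B)
  length-subformulas (A ⊃ B) = cong suc (length-subformulas-++ A B)

  length-subformulas-++ : ∀ A B → length (subformulas A ++ subformulas B) ≡ size A + size B
  length-subformulas-++ A B =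
    trans (length-++ (subformulas A)) (cong₂ _+_ (length-subformulas A) (length-subformulas B))

mutual
  subformulas-⊑ : ∀ {X Z} → X ∈ subformulas Z → subformulas X ⊑ subformulas Z
  subformulas-⊑ (here refl) = ⊆-refl
  subformulas-⊑ {Z = Z} (there x) = Z ∷ʳ ∈-properSubformulas-⊑ Z x

  ∈-properSubformulas-⊑ : ∀ {X} Z → X ∈ properSubformulas Z → subformulas X ⊑ properSubformulas Z
  ∈-properSubformulas-⊑ (A ∧' B) x = ∈-subformulas-++-⊑ A B x
  ∈-properSubformulas-⊑ (A ∨' B) x = ∈-subformulas-++-⊑ A B x
  ∈-properSubformulas-⊑ (A ⊃ B) x = ∈-subformulas-++-⊑ A B x

  ∈-subformulas-++-⊑ : ∀ {X} A B → X ∈ subformulas A ++ subformulas B →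
                       subformulas X ⊑ subformulas A ++ subformulas B
  ∈-subformulas-++-⊑ A B x =
    [ Sublist.++⁺ʳ (subformulas B) ∘ subformulas-⊑ , Sublist.++⁺ˡ (subformulas A) ∘ subformulas-⊑ ]′
      (∈-++⁻ (subformulas A) x)

size-≤ : ∀ {X Z} → X ∈ subformulas Z → size X ≤ size Z
size-≤ {X} {Z} x =
  subst₂ _≤_ (length-subformulas X) (length-subformulas Z) (Sublist.length-mono-≤ (subformulas-⊑ x))

properSubformulas-trans : ∀ {X Y} Z → Y ∈ subformulas Z → X ∈ properSubformulas Y →
                          X ∈ properSubformulas Z
properSubformulas-trans _ y = lookup (Sublist.∷⁻ (subformulas-⊑ y))

second∈ : ∀ A {B} → B ∈ subformulas A ++ subformulas B
second∈ A = ∈-++⁺ʳ (subformulas A) (here refl)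

module _ {G : Formula} where
  private
    via : ∀ {X Y} → Y ∈ subformulas G → X ∈ properSubformulas Y → X ∈ properSubformulas G
    via = properSubformulas-trans G

  mutual
    Sl⊆properSubformulas : ∀ {X} → Sl G X → X ∈ properSubformulas G
    Sl⊆properSubformulas (sl-∧₁ p) = via (there (Sl⊆properSubformulas p)) (here refl)
    Sl⊆properSubformulas (sl-∧₂ {A} p) = via (there (Sl⊆properSubformulas p)) (second∈ A)
    Sl⊆properSubformulas (sl-∨₁ p) = via (there (Sl⊆properSubformulas p)) (here refl)
    Sl⊆properSubformulas (sl-∨₂ {A} p) = via (there (Sl⊆properSubformulas p)) (second∈ A)
    Sl⊆properSubformulas (sl-⊃ {A} p) = via (there (Sl⊆properSubformulas p)) (second∈ A)
    Sl⊆properSubformulas (sr-⊃l p) = via (Sr⊆subformulas p) (here refl)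

    Sr⊆subformulas : ∀ {X} → Sr G X → X ∈ subformulas G
    Sr⊆subformulas sr-root = here refl
    Sr⊆subformulas (sr-∧₁ p) = there (via (Sr⊆subformulas p) (here refl))
    Sr⊆subformulas (sr-∧₂ {A} p) = there (via (Sr⊆subformulas p) (second∈ A))
    Sr⊆subformulas (sr-∨₁ p) = there (via (Sr⊆subformulas p) (here refl))
    Sr⊆subformulas (sr-∨₂ {A} p) = there (via (Sr⊆subformulas p) (second∈ A))
    Sr⊆subformulas (sr-⊃ {A} p) = there (via (Sr⊆subformulas p) (second∈ A))
    Sr⊆subformulas (sl-⊃l p) = there (via (there (Sl⊆properSubformulas p)) (here refl))

module _ {a ℓ} {A : Set a} {P Q : Pred A ℓ} (P? : Decidable P) (Q? : Decidable Q)
         (P⊆Q : ∀ {x} → P x → Q x) where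

  filter-⊑ : ∀ xs → filter P? xs ⊑ filter Q? xs
  filter-⊑ xs = Sublist.filter⁺ P? Q? (λ { refl → P⊆Q }) (⊆-refl {x = xs})

  length-filter-mono : ∀ xs → length (filter P? xs) ≤ length (filter Q? xs)
  length-filter-mono xs = Sublist.length-mono-≤ (filter-⊑ xs)

  length-filter-< : ∀ {x xs} → x ∈ xs → Q x → ¬ P x → length (filter P? xs) < length (filter Q? xs)
  length-filter-< {x} {xs} x∈xs Qx ¬Px = ≤∧≢⇒< (length-filter-mono xs) λ same-length →
    let filters≡ = ≋⇒≡ (Sublist.to-≋ same-length (filter-⊑ xs))
    in ¬Px (proj₂ (∈-filter⁻ P? {xs = xs} (subst (x ∈_) (sym filters≡) (∈-filter⁺ Q? x∈xs Qx))))

length-descending : ∀ {a} {A : Set a} (f : A → ℕ) {x xs} →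
                    Linked (λ x y → f y < f x) (x ∷ xs) → length xs ≤ f x
length-descending f [-] = z≤n
length-descending f (fy<fx ∷ descending) = ≤-trans (s≤s (length-descending f descending)) fy<fx

AllPairs-resp-⊑ : ∀ {a ℓ} {A : Set a} {R : A → A → Set ℓ} {xs ys} →
                  ys ⊑ xs → AllPairs R xs → AllPairs R ys
AllPairs-resp-⊑ [] [] = []
AllPairs-resp-⊑ (_ ∷ʳ ys⊑xs) (_ ∷ Rxs) = AllPairs-resp-⊑ ys⊑xs Rxs
AllPairs-resp-⊑ (refl ∷ ys⊑xs) (Rx ∷ Rxs) = Sublist.All-resp-⊆ ys⊑xs Rx ∷ AllPairs-resp-⊑ ys⊑xs Rxs

2+2m≤2n : ∀ {m n} → m < n → 2 + 2 * m ≤ 2 * n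
2+2m≤2n {m} {n} m<n = subst (_≤ 2 * n) (*-suc 2 m) (*-monoʳ-≤ 2 m<n)

lex-< : ∀ m {a a′ b b′} → b < m → a < a′ → m * a + b < m * a′ + b′
lex-< m {a} {a′} {b} {b′} b<m a<a′ = begin-strict
  m * a + b   <⟨ +-monoʳ-< (m * a) b<m ⟩
  m * a + m   ≡⟨ trans (+-comm (m * a) m) (sym (*-suc m a)) ⟩
  m * suc a   ≤⟨ *-monoʳ-≤ m a<a′ ⟩
  m * a′      ≤⟨ m≤m+n (m * a′) b′ ⟩
  m * a′ + b′ ∎
  where open ≤-Reasoning

suc-n*2n≤4n² : ∀ n → suc n * (2 * n) ≤ 4 * (n * n)
suc-n*2n≤4n² zero = z≤n
suc-n*2n≤4n² (suc n) =
  subst (suc (suc n) * (2 * suc n) ≤_) (4n²-split n) (m≤m+n _ (2 * (n * suc n)))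
  where 4n²-split : ∀ n → suc (suc n) * (2 * suc n) + 2 * (n * suc n) ≡ 4 * (suc n * suc n)
        4n²-split = solve-∀

rank : Formula → List Formula → ℕ
rank G Γ = length (filter (Cl? Γ) (properSubformulas G))

rank-⊆ : ∀ G {Γ Δ} → Δ ⊆ Γ → rank G Δ ≤ rank G Γ
rank-⊆ G {Γ} {Δ} Δ⊆Γ = length-filter-mono (Cl? Δ) (Cl? Γ) (Cl-mono Δ⊆Γ) (properSubformulas G)

rank-< : ∀ G {Γ Δ X} → (∀ {Y} → Cl Δ Y → Cl Γ Y) →
         X ∈ properSubformulas G → Cl Γ X → ¬ Cl Δ X → rank G Δ < rank G Γ
rank-< G {Γ} {Δ} ClΔ⊆ClΓ = length-filter-< (Cl? Δ) (Cl? Γ) ClΔ⊆ClΓ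

rank<size : ∀ G Γ → rank G Γ < size G
rank<size G Γ =
  subst (rank G Γ <_) (length-subformulas G) (s≤s (length-filter (Cl? Γ) (properSubformulas G)))

context : Seq → List Formula
context (reg Γ _) = Γ
context (irr Σ Θ _) = Σ ++ Θ

right : Seq → Formula
right (reg _ C) = C
right (irr _ _ C) = C

level : Formula → Seq → ℕ
level G (reg Γ _) = 2 * rank G Γ
level G (irr Σ Θ _) = suc (2 * rank G (Σ ++ Θ))

level<2*size : ∀ G σ → level G σ < 2 * size G
level<2*size G (reg Γ _) = ≤-trans (n≤1+n _) (2+2m≤2n (rank<size G Γ))
level<2*size G (irr Σ Θ _) = 2+2m≤2n (rank<size G (Σ ++ Θ))

PRight : Formula → Set
PRight (atom _) = ⊤
PRight ⊥' = ⊤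
PRight (_ ∨' _) = ⊤
PRight _ = ⊥

PShaped : Seq → Set
PShaped (reg _ C) = PRight C
PShaped (irr _ _ _) = ⊥

Var⊥⇒PRight : ∀ {F} → IsVar⊥ F → PRight F
Var⊥⇒PRight (inj₁ (_ , refl)) = tt
Var⊥⇒PRight (inj₂ refl) = tt

PRule⇒PShaped : ∀ {G ps τ} (r : Rule G ps τ) → IsPRule r → PShaped τ
PRule⇒PShaped (ax-reg F∈𝒱⊥ _) _ = Var⊥⇒PRight F∈𝒱⊥
PRule⇒PShaped (⋈At _ _ _ F∈𝒱⊥ _ _ _) _ = Var⊥⇒PRight F∈𝒱⊥
PRule⇒PShaped (⋈∨ _ _ _ _ _ _ _) _ = tt
PRule⇒PShaped (ax-irr _ _ _) ()
PRule⇒PShaped (∧-reg _ _) ()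
PRule⇒PShaped (∧-irr _ _ _) ()
PRule⇒PShaped (∨-irr _ _ _ _) ()
PRule⇒PShaped (⊃∈-reg _ _) ()
PRule⇒PShaped (⊃∈-irr _ _ _ _ _ _ _ _) ()
PRule⇒PShaped (⊃∉ _ _ _ _ _) ()

PShaped-resp-≈ : ∀ {σ τ} → σ ≈ τ → PShaped σ → PShaped τ
PShaped-resp-≈ {reg _ _} {reg _ _} (_ , refl) pσ = pσ

PSeq⇒PShaped : ∀ {G σ₀} {D : Deriv G σ₀} {σ} → PSeq D σ → PShaped σ
PSeq⇒PShaped (_ , _ , (rule , _) , _ , τ≈σ , p-rule) =
  PShaped-resp-≈ τ≈σ (PRule⇒PShaped rule p-rule)

data Descent (G : Formula) (σ τ : Seq) : Set where
  level-drop : level G τ < level G σ → Descent G σ τ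
  growth : level G τ ≤ level G σ → size (right σ) < size (right τ) → ¬ PShaped τ → Descent G σ τ

potential : Formula → Seq → ℕ
potential G σ = suc (size G) * level G σ + (size G ∸ size (right σ))

potential-< : ∀ G {σ τ} → Descent G σ τ → size (right τ) ≤ size G → potential G τ < potential G σ
potential-< G {τ = τ} (level-drop <-level) _ =
  lex-< (suc (size G)) (s≤s (m∸n≤m (size G) (size (right τ)))) <-level
potential-< G (growth ≤-level <-size _) right≤G =
  +-mono-≤-< (*-monoʳ-≤ (suc (size G)) ≤-level) (∸-monoʳ-< <-size right≤G)

potential<4*size² : ∀ G σ → potential G σ < 4 * (size G * size G)
potential<4*size² G σ = begin-strict
  potential G σ                   <⟨ lex-< (suc (size G)) right-part<suc-size (level<2*size G σ) ⟩
  suc (size G) * (2 * size G) + 0 ≡⟨ +-identityʳ _ ⟩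
  suc (size G) * (2 * size G)     ≤⟨ suc-n*2n≤4n² (size G) ⟩
  4 * (size G * size G)           ∎
  where
    open ≤-Reasoning
    right-part<suc-size = s≤s (m∸n≤m (size G) (size (right σ)))

Γbar⊆properSubformulas : ∀ {G X} → Γbar G X → X ∈ properSubformulas G
Γbar⊆properSubformulas = [ Sl⊆properSubformulas ∘ proj₁ , Sl⊆properSubformulas ∘ proj₁ ]′

WF⇒Sr-right : ∀ {G} σ → WF G σ → Sr G (right σ)
WF⇒Sr-right (reg _ _) (_ , C∈Sr) = C∈Sr
WF⇒Sr-right (irr _ _ _) (_ , _ , C∈Sr) = C∈Sr

⊎⇒++ : ∀ {Γ Σ Θ} → (∀ {X} → X ∈ Γ → X ∈ Σ ⊎ X ∈ Θ) → Γ ⊆ (Σ ++ Θ)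
⊎⇒++ f = from ++-∈⇔ ∘ f

growth-reg : ∀ G {Γ Γ′ C C′} → Γ′ ⊆ Γ → size C < size C′ → ¬ PRight C′ →
             Descent G (reg Γ C) (reg Γ′ C′)
growth-reg G Γ′⊆Γ = growth (*-monoʳ-≤ 2 (rank-⊆ G Γ′⊆Γ))

growth-irr : ∀ G {Σ Θ Σ′ Θ′ C C′} → (∀ {X} → X ∈ Σ′ ⊎ X ∈ Θ′ → X ∈ Σ ⊎ X ∈ Θ) →
             size C < size C′ → Descent G (irr Σ Θ C) (irr Σ′ Θ′ C′)
growth-irr G f <-size = growth (s≤s (*-monoʳ-≤ 2 (rank-⊆ G (⊎⇒++ (f ∘ to ++-∈⇔))))) <-size λ ()

join-drop : ∀ G {Γ Σ Θ A C} → (∀ {X} → X ∈ Γ → X ∈ Σ ⊎ X ∈ Θ) → Descent G (irr Σ Θ A) (reg Γ C)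
join-drop G f = level-drop (s≤s (*-monoʳ-≤ 2 (rank-⊆ G (⊎⇒++ f))))

join-context-⊆ : ∀ {Γ Σ Θ A} (qs : List JPrem) → Join.JoinCond qs → (Σ , Θ , A) ∈ qs →
                 (P : Formula → Set) → (∀ {X} → P X → X ∈ Θ) →
                 Γ ≐ (λ X → Join.ΣAt qs X ⊎ P X ⊎ Join.Σ⊃ qs X ⊎ Join.Θ⊃ qs X) →
                 ∀ {X} → X ∈ Γ → X ∈ Σ ⊎ X ∈ Θ
join-context-⊆ qs (Σ-covered , _) q∈qs P P⊆Θ Γ≐ {X} X∈Γ with to (Γ≐ X) X∈Γ
... | inj₁ (_ , _ , _ , _ , q′∈qs , X∈Σ′) = Σ-covered q′∈qs q∈qs X∈Σ′
... | inj₂ (inj₁ PX) = inj₂ (P⊆Θ PX)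
... | inj₂ (inj₂ (inj₁ (_ , _ , _ , _ , q′∈qs , X∈Σ′))) = Σ-covered q′∈qs q∈qs X∈Σ′
... | inj₂ (inj₂ (inj₂ (_ , _ , _ , X∈everyΘ , _))) = inj₂ (X∈everyΘ q∈qs)

⊃∉-rank-< : ∀ G {Γ Σ Θ A} → Γ ⊆ₚ Γbar G → Σ ≐ (λ _ → ⊥) →
            Θ ⊆ₚ (λ X → Cl Γ X × Γbar G X) → Cl Γ A → ¬ Cl Θ A → rank G (Σ ++ Θ) < rank G Γ
⊃∉-rank-< G {Σ = Σ} {Θ} Γ⊆Γbar Σ≐∅ Θ⊆ClΓ ClΓA ¬ClΘA =
  let X , X∈Γ , ¬ClX = Cl-generator-∉ ClΓA (¬ClΘA ∘ Cl-mono Σ++Θ⊆Θ)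
  in rank-< G (Cl-bind (proj₁ ∘ Θ⊆ClΓ ∘ Σ++Θ⊆Θ))
            (Γbar⊆properSubformulas (Γ⊆Γbar X∈Γ)) (cl-base X∈Γ) ¬ClX
  where
    Σ++Θ⊆Θ : (Σ ++ Θ) ⊆ Θ
    Σ++Θ⊆Θ = [ ⊥-elim ∘ to (Σ≐∅ _) , id ]′ ∘ ∈-++⁻ Σ

∧-size : ∀ {A A₁ A₂} → A ≡ A₁ ⊎ A ≡ A₂ → size A < size (A₁ ∧' A₂)
∧-size (inj₁ refl) = s≤s (m≤m+n _ _)
∧-size (inj₂ refl) = s≤s (m≤n+m _ _)

rule-descent : ∀ {G ps τ ρ} → Rule G ps τ → All (WF G) ps → ρ ∈ ps → Descent G ρ τ
rule-descent (ax-reg _ _) _ ()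
rule-descent (ax-irr _ _ _) _ ()
rule-descent {G} (∧-reg A∈ Γ′≋Γ) _ (here refl) = growth-reg G (proj₁ Γ′≋Γ) (∧-size A∈) λ ()
rule-descent {G} (∧-irr A∈ Σ′≋Σ Θ′≋Θ) _ (here refl) =
  growth-irr G (Sum.map (proj₁ Σ′≋Σ) (proj₁ Θ′≋Θ)) (∧-size A∈)
rule-descent {G} (∨-irr _ Σ₂⊆ Σ≐ Θ≐) _ (here refl) =
  growth-irr G [ [ inj₁ , Σ₂⊆ ]′ ∘ to (Σ≐ _) , inj₂ ∘ proj₁ ∘ to (Θ≐ _) ]′ (s≤s (m≤m+n _ _))
rule-descent {G} (∨-irr Σ₁⊆ _ Σ≐ Θ≐) _ (there (here refl)) =
  growth-irr G [ [ Σ₁⊆ , inj₁ ]′ ∘ to (Σ≐ _) , inj₂ ∘ proj₂ ∘ to (Θ≐ _) ]′ (s≤s (m≤n+m _ _))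
rule-descent {G} (⊃∈-reg Γ′≋Γ _) _ (here refl) = growth-reg G (proj₁ Γ′≋Γ) (s≤s (m≤n+m _ _)) λ ()
rule-descent {G} (⊃∈-irr _ _ Θ₀≐ Σ′≐ Θ′≋Θ _ _ _) _ (here refl) =
  growth-irr G [ [ inj₁ , inj₂ ∘ from (Θ₀≐ _) ∘ inj₂ ]′ ∘ to (Σ′≐ _)
               , inj₂ ∘ from (Θ₀≐ _) ∘ inj₁ ∘ proj₁ Θ′≋Θ ]′ (s≤s (m≤n+m _ _))
rule-descent {G} (⊃∉ Σ≐∅ Θ⊆ClΓ ClΓA ¬ClΘA _) ((Γ⊆Γbar , _) ∷ []) (here refl) =
  level-drop (2+2m≤2n (⊃∉-rank-< G Γ⊆Γbar Σ≐∅ Θ⊆ClΓ ClΓA ¬ClΘA))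
rule-descent {G} (⋈At qs _ join _ _ _ Γ≐) _ ρ∈ with ∈-map⁻ toIrr ρ∈
... | _ , q∈qs , refl =
  join-drop G (join-context-⊆ qs join q∈qs _ (λ ΘAt∧≢F → proj₂ (proj₁ ΘAt∧≢F) q∈qs) Γ≐)
rule-descent {G} (⋈∨ qs _ join _ _ _ Γ≐) _ ρ∈ with ∈-map⁻ toIrr ρ∈
... | _ , q∈qs , refl =
  join-drop G (join-context-⊆ qs join q∈qs _ (λ ΘAt → proj₂ ΘAt q∈qs) Γ≐)

≈-right : ∀ {σ τ} → σ ≈ τ → right σ ≡ right τ
≈-right {reg _ _} {reg _ _} (_ , C≡C′) = C≡C′
≈-right {irr _ _ _} {irr _ _ _} (_ , _ , C≡C′) = C≡C′

≈-level : ∀ G {σ τ} → σ ≈ τ → level G τ ≤ level G σ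
≈-level G {reg _ _} {reg _ _} ((_ , Γ′⊆Γ) , _) = *-monoʳ-≤ 2 (rank-⊆ G Γ′⊆Γ)
≈-level G {irr _ _ _} {irr _ _ _} ((_ , Σ′⊆Σ) , (_ , Θ′⊆Θ) , _) =
  s≤s (*-monoʳ-≤ 2 (rank-⊆ G (Subset.++⁺ Σ′⊆Σ Θ′⊆Θ)))

Descent-resp-≈ : ∀ {G σ ρ τ} → σ ≈ ρ → Descent G ρ τ → Descent G σ τ
Descent-resp-≈ {G} σ≈ρ (level-drop <-level) = level-drop (<-≤-trans <-level (≈-level G σ≈ρ))
Descent-resp-≈ {G} {τ = τ} σ≈ρ (growth ≤-level <-size ¬pτ) =
  growth (≤-trans ≤-level (≈-level G σ≈ρ))
         (subst (λ C → size C < size (right τ)) (sym (≈-right σ≈ρ)) <-size) ¬pτ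

↦₀-descent : ∀ {G σ τ} → _↦₀_ {G} σ τ → Descent G σ τ
↦₀-descent (_ , (rule , premises-wf , _) , σ≈premise) =
  let ρ , ρ∈premises , σ≈ρ = find σ≈premise
  in Descent-resp-≈ σ≈ρ (rule-descent rule premises-wf ρ∈premises)

↦₀-right-≤ : ∀ {G σ τ} → _↦₀_ {G} σ τ → size (right τ) ≤ size G
↦₀-right-≤ {τ = τ} (_ , (_ , _ , τ-wf) , _) = size-≤ (Sr⊆subformulas (WF⇒Sr-right τ τ-wf))

branch-length : ∀ {G B} → Linked (_↦₀_ {G}) B → length B ≤ 4 * (size G * size G)
branch-length [] = z≤n
branch-length {G} {σ ∷ _} linked =
  ≤-trans (s≤s (length-descending (potential G) (Linked.map potential-step linked)))
          (potential<4*size² G σ)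
  where potential-step : ∀ {σ τ} → _↦₀_ {G} σ τ → potential G τ < potential G σ
        potential-step step = potential-< G (↦₀-descent step) (↦₀-right-≤ step)

record Dominates (G : Formula) (σ τ : Seq) : Set where
  constructor dominates
  field
    level-≤ : level G τ ≤ level G σ
    level-< : PShaped τ → level G τ < level G σ

Descent⇒Dominates : ∀ {G σ τ} → Descent G σ τ → Dominates G σ τ
Descent⇒Dominates (level-drop <-level) = dominates (<⇒≤ <-level) λ _ → <-level
Descent⇒Dominates (growth ≤-level _ ¬pτ) = dominates ≤-level (⊥-elim ∘ ¬pτ)

Dominates-trans : ∀ G → Transitive (Dominates G)
Dominates-trans G (dominates ≤₁ <₁) (dominates ≤₂ <₂) =
  dominates (≤-trans ≤₂ ≤₁) λ pτ → <-≤-trans (<₂ pτ) ≤₁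

PShaped-rank-< : ∀ G {σ τ} → PShaped σ → PShaped τ → level G τ < level G σ →
                 rank G (context τ) < rank G (context σ)
PShaped-rank-< G {reg _ _} {reg _ _} _ _ = *-cancelˡ-< 2 _ _

PShaped-descending : ∀ G {σs} → AllPairs (Dominates G) σs → All PShaped σs →
                     Linked (λ σ τ → rank G (context τ) < rank G (context σ)) σs
PShaped-descending G [] [] = []
PShaped-descending G (_ ∷ []) _ = [-]
PShaped-descending G {σ ∷ τ ∷ _} ((σ≽τ ∷ _) ∷ rest) (pσ ∷ pτ ∷ pshaped) =
  PShaped-rank-< G {σ} {τ} pσ pτ (Dominates.level-< σ≽τ pτ)
    ∷ PShaped-descending G rest (pτ ∷ pshaped)

PShaped-count : ∀ {G B B′} → Linked (_↦₀_ {G}) B → B′ ⊑ B → All PShaped B′ → length B′ ≤ size G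
PShaped-count {B′ = []} _ _ _ = z≤n
PShaped-count {G} {B′ = σ ∷ _} linked B′⊑B pshaped =
  ≤-trans (s≤s (length-descending (rank G ∘ context) descending)) (rank<size G (context σ))
  where
    all-dominate =
      Linked⇒AllPairs (Dominates-trans G) (Linked.map (Descent⇒Dominates ∘ ↦₀-descent) linked)
    descending = PShaped-descending G (AllPairs-resp-⊑ B′⊑B all-dominate) pshaped

lemma3p13 : Σ ℕ (λ c → ∀ (G : Formula) {σ : Seq} (D : Deriv G σ) (B : List Seq) →
                Branch D B →
                (length B ≤ c * (size G * size G))
                × (∀ (B' : List Seq) → B' ⊑ B → All (PSeq D) B' → length B' ≤ size G))
lemma3p13 = 4 , λ G D B (_ , linked) →
  branch-length linked ,
  λ B′ B′⊑B p-sequents → PShaped-count linked B′⊑B (All.map PSeq⇒PShaped p-sequents)
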